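{- For integers $j\ge0$, $k\ge0$, $m\ge1$ and $r\in\{0,1,\ldots,m-1\}$, \[ \left\langle {mj+r-k \atop k}\right\rangle_m=[x^k]\,f_j(x)^{m-r}f_{j+1}(x)^r, \] where $\left\langle {n \atop k}\right\rangle_m$ and $f_n(x)$ are as defined in the context.
   Context: An $N$-board is a linear array of $N$ unit square cells. A square is a $1\times1$ tile. For $m\ge1$, a $(1,m-1)$-fence is a tile consisting of two unit square sub-tiles (posts) separated by a gap of width $m-1$ (for $m=1$ it is a domino); when tiling, the gap of a fence may be occupied by other tiles (including posts of other fences). For integers $n,k$, $\left\langle {n \atop k}\right\rangle_m$ denotes the number of tilings of an $(n+k)$-board using exactly $k$ $(1,m-1)$-fences and $n-k$ squares (i.e. $n$-tile tilings with $k$ fences); it is $0$ when $k>n$ or $k<0$. The Fibonacci polynomials are defined by $f_n(x)=f_{n-1}(x)+xf_{n-2}(x)+\delta_{n,0}$ with $f_n(x)=0$ for $n<0$ (so $f_0=f_1=1$, $f_2=1+x$, $f_3=1+2x$, \dots). $[x^k]$ denotes the coefficient of $x^k$. -}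

module Defs where

open import Data.Nat using (ℕ; zero; suc; _+_; _*_; _∸_; _≡ᵇ_; _<ᵇ_)
open import Data.Bool using (Bool; true; false; _∧_; _∨_; if_then_else_)
open import Data.List using (List; []; _∷_; _++_; map; length; filter; upTo; foldr)

-- A placed tile is a square at cell p (covering {p}) or a fence whose
-- left post is at cell p (covering {p, p+m}; the gap p+1 … p+m-1 is not
-- covered by the fence and may hold other tiles).  Since tiles of the
-- same kind are indistinguishable, a tiling is a set of placed tiles in
-- which every cell of the board is covered exactly once.

data Tile : Set where
  sq    : ℕ → Tile
  fence : ℕ → Tile

covers : ℕ → Tile → ℕ → Bool
covers m (sq p)    c = p ≡ᵇ c
covers m (fence p) c = (p ≡ᵇ c) ∨ ((p + m) ≡ᵇ c)

isFence : Tile → Bool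
isFence (sq _)    = false
isFence (fence _) = true

-- all tiles that fit inside an N-board: squares at 0..N-1,
-- fences with p + m < N, i.e. p < N ∸ m.
candidates : ℕ → ℕ → List Tile
candidates m N = map sq (upTo N) ++ map fence (upTo (N ∸ m))

subsets : {A : Set} → List A → List (List A)
subsets []       = [] ∷ []
subsets (x ∷ xs) = subsets xs ++ map (x ∷_) (subsets xs)

countB : {A : Set} → (A → Bool) → List A → ℕ
countB p []       = 0
countB p (x ∷ xs) = if p x then suc (countB p xs) else countB p xs

allB : {A : Set} → (A → Bool) → List A → Bool
allB p = foldr (λ x b → p x ∧ b) true

isTilingB : ℕ → ℕ → List Tile → Bool
isTilingB m N S = allB (λ c → countB (λ t → covers m t c) S ≡ᵇ 1) (upTo N)

-- ⟨ n k ⟩_m : tilings of an (n+k)-board with exactly k fences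
-- (and hence n-k squares).  Automatically 0 when k > n.
fenceTilings : (m n k : ℕ) → ℕ
fenceTilings m n k =
  countB (λ S → isTilingB m (n + k) S ∧ (countB isFence S ≡ᵇ k))
         (subsets (candidates m (n + k)))

Poly : Set
Poly = ℕ → ℕ

coeff : ℕ → Poly → ℕ
coeff k p = p k

one : Poly
one zero    = 1
one (suc _) = 0

_⊕_ : Poly → Poly → Poly
(p ⊕ q) k = p k + q k

xTimes : Poly → Poly
xTimes p zero    = 0
xTimes p (suc k) = p k

-- Σ_{i=0}^{k} p i * q (k - i)
convo : Poly → Poly → ℕ → ℕ
convo p q zero    = p 0 * q 0
convo p q (suc k) = p 0 * q (suc k) + convo (λ i → p (suc i)) q k

_⊛_ : Poly → Poly → Poly
(p ⊛ q) k = convo p q k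

_^ₚ_ : Poly → ℕ → Poly
p ^ₚ zero  = one
p ^ₚ suc e = p ⊛ (p ^ₚ e)

-- Fibonacci polynomials: f_n = f_{n-1} + x f_{n-2} + δ_{n,0}, f_n = 0 for n < 0
fib : ℕ → Poly
fib zero                = one               -- 0 + x·0 + 1
fib (suc zero)          = fib zero          -- f_0 + x·0
fib (suc (suc n))       = fib (suc n) ⊕ xTimes (fib n)

{-# OPTIONS --safe #-}

-- The k-th coefficient of boardPoly m N, the sum of x^(number of fences) over all exact
-- covers of the N-board, is ⟨ N - k , k ⟩_m.  Every tile covers cells of a single residue
-- class mod m, so this sum factors into one factor per class.  For N = j m + r the class
-- of c consists of the cells c, c + m, c + 2m, …, which are j + 1 in number if c < r and j
-- otherwise, and a fence covers two consecutive ones.  Each class is therefore a board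
-- tiled by squares and dominoes; its polynomial satisfies the Fibonacci recurrence, since
-- the first cell is covered either by a square or by a fence that also covers the second.

module Submission where

open import Defs
open import Data.Nat using (ℕ; zero; suc; NonZero; _%_; _+_; _*_; _∸_; _≡ᵇ_; _<ᵇ_; _≤_; _<_; z≤n; s≤s)
open import Data.Nat.Properties
  using ( _≟_; _≤?_; ≡ᵇ⇒≡; suc-injective; ≤-refl; <⇒≤; <⇒≢; ≰⇒>; <-trans; ≤-<-trans
        ; m≤n⇒m≤1+n; m<n⇒m<1+n; m≤n+m; m∸n≤m; m∸n+n≡m; m+n∸m≡n; m≤n⇒m∸n≡0
        ; +-identityʳ; +-assoc; +-comm; +-suc; +-cancelˡ-≡; *-comm; *-zeroʳ; *-cancelʳ-≡
        ; *-distribʳ-+; *-distribˡ-+; +-commutativeSemigroup )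
open import Data.Bool using (Bool; true; false; _∧_; _∨_; not; if_then_else_; T; T?)
open import Data.Bool.Properties using (∧-assoc; ∧-zeroʳ; ∧-identityʳ; ∨-identityʳ; not-involutive)
open import Data.List using (List; []; _∷_; [_]; _++_; map; filterᵇ; length; applyUpTo; upTo)
open import Data.List.Properties using (map-applyUpTo; filter-++; length-upTo; upTo-∷ʳ; applyUpTo-∷ʳ; ++-identityʳ)
open import Data.Nat.DivMod using (m%n<n; [m+n]%n≡m%n; [m+kn]%n≡m%n; m<n⇒m%n≡m)
open import Data.Empty using (⊥-elim)
open import Relation.Nullary using (Dec; yes; no)
open import Data.List.Relation.Binary.Sublist.Propositional using (_⊆_; []; _∷_; _∷ʳ_)
open import Data.List.Relation.Binary.Permutation.Propositional as ↭ using (_↭_)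
open import Data.List.Relation.Binary.Permutation.Propositional.Properties using (filter-↭; ↭-length; shift)
open import Function using (_∘_)
open import Relation.Binary.PropositionalEquality hiding ([_])
open import Algebra.Properties.CommutativeSemigroup +-commutativeSemigroup using (interchange)

≡ᵇ≡true⇒≡ : ∀ {i j} → (i ≡ᵇ j) ≡ true → i ≡ j
≡ᵇ≡true⇒≡ {i} {j} eq = ≡ᵇ⇒≡ i j (subst T (sym eq) _)

≡ᵇ-refl : ∀ n → (n ≡ᵇ n) ≡ true
≡ᵇ-refl zero    = refl
≡ᵇ-refl (suc n) = ≡ᵇ-refl n

≢⇒≡ᵇ≡false : ∀ {i j} → i ≢ j → (i ≡ᵇ j) ≡ false
≢⇒≡ᵇ≡false {i} {j} i≢j with i ≡ᵇ j in eq
... | false = refl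
... | true  = ⊥-elim (i≢j (≡ᵇ≡true⇒≡ eq))

≡ᵇ-injective : ∀ {f : ℕ → ℕ} → (∀ {i j} → f i ≡ f j → i ≡ j) → ∀ i j → (f i ≡ᵇ f j) ≡ (i ≡ᵇ j)
≡ᵇ-injective {f} inj i j with i ≟ j
... | yes refl = trans (≡ᵇ-refl (f i)) (sym (≡ᵇ-refl i))
... | no  i≢j  = trans (≢⇒≡ᵇ≡false (i≢j ∘ inj)) (sym (≢⇒≡ᵇ≡false i≢j))

<⇒<ᵇ≡true : ∀ {i j} → i < j → (i <ᵇ j) ≡ true
<⇒<ᵇ≡true {zero}  (s≤s _)   = refl
<⇒<ᵇ≡true {suc i} (s≤s i<j) = <⇒<ᵇ≡true i<j

≤⇒<ᵇ≡false : ∀ {i j} → j ≤ i → (i <ᵇ j) ≡ false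
≤⇒<ᵇ≡false z≤n       = refl
≤⇒<ᵇ≡false (s≤s j≤i) = ≤⇒<ᵇ≡false j≤i

<ᵇ-suc : ∀ i j → (i <ᵇ suc j) ≡ (i <ᵇ j) ∨ (i ≡ᵇ j)
<ᵇ-suc zero    zero    = refl
<ᵇ-suc zero    (suc j) = refl
<ᵇ-suc (suc i) zero    = refl
<ᵇ-suc (suc i) (suc j) = <ᵇ-suc i j

infix 4 _≈ₚ_
_≈ₚ_ : Poly → Poly → Set
p ≈ₚ q = ∀ k → p k ≡ q k

0ₚ : Poly
0ₚ _ = 0

infix 25 [_]x^_
[_]x^_ : Bool → ℕ → Poly
([ b ]x^ a) k = if b ∧ (a ≡ᵇ k) then 1 else 0

⊛-cong : ∀ {p p′ q q′} → p ≈ₚ p′ → q ≈ₚ q′ → p ⊛ q ≈ₚ p′ ⊛ q′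
⊛-cong p≈ q≈ zero    = cong₂ _*_ (p≈ 0) (q≈ 0)
⊛-cong p≈ q≈ (suc k) = cong₂ _+_ (cong₂ _*_ (p≈ 0) (q≈ (suc k))) (⊛-cong (p≈ ∘ suc) q≈ k)

⊛-distribʳ-⊕ : ∀ p p′ q → (p ⊕ p′) ⊛ q ≈ₚ (p ⊛ q) ⊕ (p′ ⊛ q)
⊛-distribʳ-⊕ p p′ q zero    = *-distribʳ-+ (q 0) (p 0) (p′ 0)
⊛-distribʳ-⊕ p p′ q (suc k) = trans
  (cong₂ _+_ (*-distribʳ-+ (q (suc k)) (p 0) (p′ 0)) (⊛-distribʳ-⊕ (p ∘ suc) (p′ ∘ suc) q k))
  (interchange (p 0 * q (suc k)) (p′ 0 * q (suc k)) (convo (p ∘ suc) q k) (convo (p′ ∘ suc) q k))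

⊛-distribˡ-⊕ : ∀ p q q′ → p ⊛ (q ⊕ q′) ≈ₚ (p ⊛ q) ⊕ (p ⊛ q′)
⊛-distribˡ-⊕ p q q′ zero    = *-distribˡ-+ (p 0) (q 0) (q′ 0)
⊛-distribˡ-⊕ p q q′ (suc k) = trans
  (cong₂ _+_ (*-distribˡ-+ (p 0) (q (suc k)) (q′ (suc k))) (⊛-distribˡ-⊕ (p ∘ suc) q q′ k))
  (interchange (p 0 * q (suc k)) (p 0 * q′ (suc k)) (convo (p ∘ suc) q k) (convo (p ∘ suc) q′ k))

⊛-zeroˡ : ∀ q → 0ₚ ⊛ q ≈ₚ 0ₚ
⊛-zeroˡ q zero    = refl
⊛-zeroˡ q (suc k) = ⊛-zeroˡ q k

⊛-zeroʳ : ∀ p → p ⊛ 0ₚ ≈ₚ 0ₚ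
⊛-zeroʳ p zero    = *-zeroʳ (p 0)
⊛-zeroʳ p (suc k) = cong₂ _+_ (*-zeroʳ (p 0)) (⊛-zeroʳ (p ∘ suc) k)

x^-⊛ : ∀ a b → [ true ]x^ a ⊛ [ true ]x^ b ≈ₚ [ true ]x^ (a + b)
x^-⊛ zero    b zero    = +-identityʳ _
x^-⊛ zero    b (suc k) = trans (cong₂ _+_ (+-identityʳ _) (⊛-zeroˡ ([ true ]x^ b) k)) (+-identityʳ _)
x^-⊛ (suc a) b zero    = refl
x^-⊛ (suc a) b (suc k) = x^-⊛ a b k

[]x^-⊛ : ∀ b b′ a a′ → [ b ]x^ a ⊛ [ b′ ]x^ a′ ≈ₚ [ b ∧ b′ ]x^ (a + a′)
[]x^-⊛ false b′    a a′ = ⊛-zeroˡ ([ b′ ]x^ a′)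
[]x^-⊛ true  false a a′ = ⊛-zeroʳ ([ true ]x^ a)
[]x^-⊛ true  true  a a′ = x^-⊛ a a′

x^-suc : ∀ b a → [ b ]x^ suc a ≈ₚ xTimes ([ b ]x^ a)
x^-suc false a zero    = refl
x^-suc false a (suc k) = refl
x^-suc true  a zero    = refl
x^-suc true  a (suc k) = refl

[]x^-vanish : ∀ b {a k} → a < k → ([ b ]x^ a) k ≡ 0
[]x^-vanish false     _   = refl
[]x^-vanish true  {a} a<k rewrite ≢⇒≡ᵇ≡false (<⇒≢ a<k) = refl

xTimes-cong : ∀ {p q} → p ≈ₚ q → xTimes p ≈ₚ xTimes q
xTimes-cong p≈q zero    = refl
xTimes-cong p≈q (suc k) = p≈q k

module _ {A : Set} where

  countB-++ : ∀ (p : A → Bool) xs ys → countB p (xs ++ ys) ≡ countB p xs + countB p ys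
  countB-++ p []       ys = refl
  countB-++ p (x ∷ xs) ys with p x
  ... | true  = cong suc (countB-++ p xs ys)
  ... | false = countB-++ p xs ys

  countB-map : ∀ {B : Set} (p : A → Bool) (f : B → A) xs → countB p (map f xs) ≡ countB (p ∘ f) xs
  countB-map p f []       = refl
  countB-map p f (x ∷ xs) with p (f x)
  ... | true  = cong suc (countB-map p f xs)
  ... | false = countB-map p f xs

  countB≡length∘filterᵇ : ∀ (p : A → Bool) xs → countB p xs ≡ length (filterᵇ p xs)
  countB≡length∘filterᵇ p []       = refl
  countB≡length∘filterᵇ p (x ∷ xs) with p x
  ... | true  = cong suc (countB≡length∘filterᵇ p xs)
  ... | false = countB≡length∘filterᵇ p xs

  countB-↭ : ∀ (p : A → Bool) {xs ys} → xs ↭ ys → countB p xs ≡ countB p ys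
  countB-↭ p {xs} {ys} xs↭ys = begin
    countB p xs                ≡⟨ countB≡length∘filterᵇ p xs ⟩
    length (filterᵇ p xs)      ≡⟨ ↭-length (filter-↭ (T? ∘ p) xs↭ys) ⟩
    length (filterᵇ p ys)      ≡⟨ countB≡length∘filterᵇ p ys ⟨
    countB p ys                ∎
    where open ≡-Reasoning

  countB-mono-⊆ : ∀ (p : A → Bool) {xs ys} → xs ⊆ ys → countB p xs ≤ countB p ys
  countB-mono-⊆ p []            = z≤n
  countB-mono-⊆ p (y ∷ʳ xs⊆ys) with p y
  ... | true  = m≤n⇒m≤1+n (countB-mono-⊆ p xs⊆ys)
  ... | false = countB-mono-⊆ p xs⊆ys
  countB-mono-⊆ p {x ∷ _} (refl ∷ xs⊆ys) with p x
  ... | true  = s≤s (countB-mono-⊆ p xs⊆ys)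
  ... | false = countB-mono-⊆ p xs⊆ys

  allB-⊆ : ∀ (p : A → Bool) {xs ys} → xs ⊆ ys → allB p ys ≡ true → allB p xs ≡ true
  allB-⊆ p []             _  = refl
  allB-⊆ p (y ∷ʳ xs⊆ys)   ys = allB-⊆ p xs⊆ys (∧-trueʳ ys)
    where ∧-trueʳ : ∀ {a b} → a ∧ b ≡ true → b ≡ true
          ∧-trueʳ {true} e = e
  allB-⊆ p {x ∷ _} (refl ∷ xs⊆ys) ys with p x
  ... | true = allB-⊆ p xs⊆ys ys

  filterᵇ-accept : ∀ (p : A → Bool) {x} xs → p x ≡ true → filterᵇ p (x ∷ xs) ≡ x ∷ filterᵇ p xs
  filterᵇ-accept p xs px rewrite px = refl

  filterᵇ-reject : ∀ (p : A → Bool) {x} xs → p x ≡ false → filterᵇ p (x ∷ xs) ≡ filterᵇ p xs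
  filterᵇ-reject p xs px rewrite px = refl

  filterᵇ-cong : ∀ {p p′ : A → Bool} → (∀ x → p x ≡ p′ x) → ∀ xs → filterᵇ p xs ≡ filterᵇ p′ xs
  filterᵇ-cong p≡ []       = refl
  filterᵇ-cong {p} {p′} p≡ (x ∷ xs) rewrite p≡ x with p′ x
  ... | true  = cong (x ∷_) (filterᵇ-cong p≡ xs)
  ... | false = filterᵇ-cong p≡ xs

  filterᵇ-filterᵇ : ∀ (p q : A → Bool) xs → filterᵇ p (filterᵇ q xs) ≡ filterᵇ (λ x → q x ∧ p x) xs
  filterᵇ-filterᵇ p q []       = refl
  filterᵇ-filterᵇ p q (x ∷ xs) with q x
  ... | false = filterᵇ-filterᵇ p q xs
  ... | true with p x
  ...   | true  = cong (x ∷_) (filterᵇ-filterᵇ p q xs)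
  ...   | false = filterᵇ-filterᵇ p q xs

  filterᵇ-map : ∀ {B : Set} (p : A → Bool) (f : B → A) xs → filterᵇ p (map f xs) ≡ map f (filterᵇ (p ∘ f) xs)
  filterᵇ-map p f []       = refl
  filterᵇ-map p f (x ∷ xs) with p (f x)
  ... | true  = cong (f x ∷_) (filterᵇ-map p f xs)
  ... | false = filterᵇ-map p f xs

  filterᵇ-true : ∀ xs → filterᵇ (λ (_ : A) → true) xs ≡ xs
  filterᵇ-true []       = refl
  filterᵇ-true (x ∷ xs) = cong (x ∷_) (filterᵇ-true xs)

  filterᵇ-false : ∀ xs → filterᵇ (λ (_ : A) → false) xs ≡ []
  filterᵇ-false []       = refl
  filterᵇ-false (x ∷ xs) = filterᵇ-false xs

  countB-partition : ∀ (r q : A → Bool) xs → countB r xs ≡ countB r (filterᵇ q xs) + countB r (filterᵇ (not ∘ q) xs)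
  countB-partition r q []       = refl
  countB-partition r q (x ∷ xs) with q x
  ... | true  with r x
  ...   | true  = cong suc (countB-partition r q xs)
  ...   | false = countB-partition r q xs
  countB-partition r q (x ∷ xs) | false with r x
  ...   | true  = trans (cong suc (countB-partition r q xs)) (sym (+-suc _ _))
  ...   | false = countB-partition r q xs

  countB-filterᵇ : ∀ (r q : A → Bool) → (∀ x → r x ≡ true → q x ≡ true) →
    ∀ xs → countB r (filterᵇ q xs) ≡ countB r xs
  countB-filterᵇ r q r⇒q []       = refl
  countB-filterᵇ r q r⇒q (x ∷ xs) with q x in qx
  ... | true  with r x
  ...   | true  = cong suc (countB-filterᵇ r q r⇒q xs)
  ...   | false = countB-filterᵇ r q r⇒q xs
  countB-filterᵇ r q r⇒q (x ∷ xs) | false with r x in rx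
  ...   | false = countB-filterᵇ r q r⇒q xs
  ...   | true  with () ← trans (sym qx) (r⇒q x rx)

  countB-none : ∀ (r : A → Bool) xs → allB (not ∘ r) xs ≡ true → countB r xs ≡ 0
  countB-none r []       _ = refl
  countB-none r (x ∷ xs) h with r x
  ... | false = countB-none r xs h

  countB≡ᵇ0 : ∀ (r : A → Bool) xs → (countB r xs ≡ᵇ 0) ≡ allB (not ∘ r) xs
  countB≡ᵇ0 r []       = refl
  countB≡ᵇ0 r (x ∷ xs) with r x
  ... | true  = refl
  ... | false = countB≡ᵇ0 r xs

  allB-cong : ∀ {p p′ : A → Bool} → (∀ x → p x ≡ p′ x) → ∀ xs → allB p xs ≡ allB p′ xs
  allB-cong p≡ []       = refl
  allB-cong p≡ (x ∷ xs) = cong₂ _∧_ (p≡ x) (allB-cong p≡ xs)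

  allB-++ : ∀ (p : A → Bool) xs ys → allB p (xs ++ ys) ≡ allB p xs ∧ allB p ys
  allB-++ p []       ys = refl
  allB-++ p (x ∷ xs) ys = trans (cong (p x ∧_) (allB-++ p xs ys)) (sym (∧-assoc (p x) _ _))

  allB-partition : ∀ (P p : A → Bool) xs → allB P xs ≡ allB P (filterᵇ p xs) ∧ allB P (filterᵇ (not ∘ p) xs)
  allB-partition P p []       = refl
  allB-partition P p (x ∷ xs) with p x
  ... | true  = trans (cong (P x ∧_) (allB-partition P p xs)) (sym (∧-assoc (P x) _ _))
  ... | false = trans (cong (P x ∧_) (allB-partition P p xs)) (∧-left-comm (P x) (allB P (filterᵇ p xs)) _)
    where
    ∧-left-comm : ∀ a b c → a ∧ (b ∧ c) ≡ b ∧ (a ∧ c)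
    ∧-left-comm true  b c = refl
    ∧-left-comm false b c = sym (∧-zeroʳ b)

  allB-cong-filterᵇ : ∀ (p : A → Bool) {P P′ : A → Bool} → (∀ x → p x ≡ true → P x ≡ P′ x) →
    ∀ xs → allB P (filterᵇ p xs) ≡ allB P′ (filterᵇ p xs)
  allB-cong-filterᵇ p P≡ []       = refl
  allB-cong-filterᵇ p P≡ (x ∷ xs) with p x in px
  ... | true  = cong₂ _∧_ (P≡ x px) (allB-cong-filterᵇ p P≡ xs)
  ... | false = allB-cong-filterᵇ p P≡ xs

allB-applyUpTo : ∀ {A : Set} (p : A → Bool) (f : ℕ → A) → (∀ i → p (f i) ≡ true) →
  ∀ n → allB p (applyUpTo f n) ≡ true
allB-applyUpTo p f h zero    = refl
allB-applyUpTo p f h (suc n) rewrite h 0 = allB-applyUpTo p (f ∘ suc) (h ∘ suc) n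

filterᵇ-applyUpTo-drop-head : ∀ {A : Set} (p : A → Bool) (f : ℕ → A) →
  p (f 0) ≡ false → (∀ i → p (f (suc i)) ≡ true) →
  ∀ n → filterᵇ p (applyUpTo f n) ≡ applyUpTo (f ∘ suc) (n ∸ 1)
filterᵇ-applyUpTo-drop-head p f h₀ hₛ zero    = refl
filterᵇ-applyUpTo-drop-head p f h₀ hₛ (suc n) rewrite h₀ = keep-all (f ∘ suc) hₛ n
  where
  keep-all : ∀ g → (∀ i → p (g i) ≡ true) → ∀ n → filterᵇ p (applyUpTo g n) ≡ applyUpTo g n
  keep-all g h zero    = refl
  keep-all g h (suc n) rewrite h 0 = cong (g 0 ∷_) (keep-all (g ∘ suc) (h ∘ suc) n)

module _ {A : Set} where

  subsetSum : (List A → Poly) → List A → Poly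
  subsetSum W []       = W []
  subsetSum W (x ∷ xs) = subsetSum W xs ⊕ subsetSum (W ∘ (x ∷_)) xs

  countB-subsets : ∀ (b : List A → Bool) (a : List A → ℕ) xs k →
    countB (λ S → b S ∧ (a S ≡ᵇ k)) (subsets xs) ≡ subsetSum (λ S → [ b S ]x^ a S) xs k
  countB-subsets b a []       k = refl
  countB-subsets b a (x ∷ xs) k = trans
    (countB-++ _ (subsets xs) (map (x ∷_) (subsets xs)))
    (cong₂ _+_ (countB-subsets b a xs k)
               (trans (countB-map _ (x ∷_) (subsets xs)) (countB-subsets (b ∘ (x ∷_)) (a ∘ (x ∷_)) xs k)))

  subsetSum-cong-⊆ : ∀ {W W′ : List A → Poly} xs k →
    (∀ {S} → S ⊆ xs → W S k ≡ W′ S k) → subsetSum W xs k ≡ subsetSum W′ xs k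
  subsetSum-cong-⊆ []       k W≡ = W≡ []
  subsetSum-cong-⊆ (x ∷ xs) k W≡ =
    cong₂ _+_ (subsetSum-cong-⊆ xs k (W≡ ∘ (x ∷ʳ_))) (subsetSum-cong-⊆ xs k (W≡ ∘ (refl ∷_)))

  subsetSum-zero : ∀ xs → subsetSum (λ _ → 0ₚ) xs ≈ₚ 0ₚ
  subsetSum-zero []       k = refl
  subsetSum-zero (x ∷ xs) k = cong₂ _+_ (subsetSum-zero xs k) (subsetSum-zero xs k)

  subsetSum-xTimes : ∀ W xs → subsetSum (xTimes ∘ W) xs ≈ₚ xTimes (subsetSum W xs)
  subsetSum-xTimes W []       k       = refl
  subsetSum-xTimes W (x ∷ xs) zero    =
    cong₂ _+_ (subsetSum-xTimes W xs zero) (subsetSum-xTimes (W ∘ (x ∷_)) xs zero)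
  subsetSum-xTimes W (x ∷ xs) (suc k) =
    cong₂ _+_ (subsetSum-xTimes W xs (suc k)) (subsetSum-xTimes (W ∘ (x ∷_)) xs (suc k))

  subsetSum-filterᵇ : ∀ (a : A → Bool) {W : List A → Poly} →
    (∀ S → allB a S ≡ false → W S ≈ₚ 0ₚ) → ∀ xs → subsetSum W xs ≈ₚ subsetSum W (filterᵇ a xs)
  subsetSum-filterᵇ a W≈0 []       k = refl
  subsetSum-filterᵇ a {W} W≈0 (x ∷ xs) k with a x in ax
  ... | true  = cong₂ _+_ (subsetSum-filterᵇ a W≈0 xs k)
                          (subsetSum-filterᵇ a (λ S bad → W≈0 (x ∷ S) (trans (cong (_∧ allB a S) ax) bad)) xs k)
  ... | false = begin
    subsetSum W xs k + subsetSum (W ∘ (x ∷_)) xs k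
      ≡⟨ cong (subsetSum W xs k +_) (subsetSum-cong-⊆ xs k (λ {S} _ → W≈0 (x ∷ S) (cong (_∧ allB a S) ax) k)) ⟩
    subsetSum W xs k + subsetSum (λ _ → 0ₚ) xs k    ≡⟨ cong (subsetSum W xs k +_) (subsetSum-zero xs k) ⟩
    subsetSum W xs k + 0                             ≡⟨ +-identityʳ _ ⟩
    subsetSum W xs k                                 ≡⟨ subsetSum-filterᵇ a W≈0 xs k ⟩
    subsetSum W (filterᵇ a xs) k                     ∎
    where open ≡-Reasoning

  subsetSum-↭ : ∀ {W : List A → Poly} → (∀ {S S′} → S ↭ S′ → W S ≈ₚ W S′) →
    ∀ {xs ys} → xs ↭ ys → subsetSum W xs ≈ₚ subsetSum W ys
  subsetSum-↭ W↭ ↭.refl          k = refl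
  subsetSum-↭ W↭ (↭.prep x p)    k =
    cong₂ _+_ (subsetSum-↭ W↭ p k) (subsetSum-↭ (λ q → W↭ (↭.prep x q)) p k)
  subsetSum-↭ W↭ (↭.trans p q)   k = trans (subsetSum-↭ W↭ p k) (subsetSum-↭ W↭ q k)
  subsetSum-↭ {W} W↭ (↭.swap {xs} {ys} x y p) k = begin
    (Σₖ W xs + Σₖ (W ∘ (y ∷_)) xs) + (Σₖ (W ∘ (x ∷_)) xs + Σₖ (λ S → W (x ∷ y ∷ S)) xs)
      ≡⟨ cong₂ _+_ (cong₂ _+_ (subsetSum-↭ W↭ p k) (subsetSum-↭ (λ q → W↭ (↭.prep y q)) p k))
                   (cong₂ _+_ (subsetSum-↭ (λ q → W↭ (↭.prep x q)) p k)
                              (trans (subsetSum-↭ (λ q → W↭ (↭.prep x (↭.prep y q))) p k)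
                                     (subsetSum-cong-⊆ ys k (λ {S} _ → W↭ (↭.swap x y (↭.refl {xs = S})) k)))) ⟩
    (Σₖ W ys + Σₖ (W ∘ (y ∷_)) ys) + (Σₖ (W ∘ (x ∷_)) ys + Σₖ (λ S → W (y ∷ x ∷ S)) ys)
      ≡⟨ interchange (Σₖ W ys) _ _ _ ⟩
    (Σₖ W ys + Σₖ (W ∘ (x ∷_)) ys) + (Σₖ (W ∘ (y ∷_)) ys + Σₖ (λ S → W (y ∷ x ∷ S)) ys) ∎
    where
    open ≡-Reasoning
    Σₖ : (List A → Poly) → List A → ℕ
    Σₖ V zs = subsetSum V zs k

  subsetSum-⊛ : ∀ (q : A → Bool) (F G : List A → Poly) xs →
    subsetSum (λ S → F (filterᵇ q S) ⊛ G (filterᵇ (not ∘ q) S)) xs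
      ≈ₚ subsetSum F (filterᵇ q xs) ⊛ subsetSum G (filterᵇ (not ∘ q) xs)
  subsetSum-⊛ q F G []       k = refl
  subsetSum-⊛ q F G (x ∷ xs) k = by-head (q x) refl
    where
    open ≡-Reasoning
    H : (List A → Poly) → (List A → Poly) → List A → Poly
    H F′ G′ S = F′ (filterᵇ q S) ⊛ G′ (filterᵇ (not ∘ q) S)
    Σ : (List A → Poly) → List A → Poly
    Σ = subsetSum
    ΣF ΣG : Poly
    ΣF = Σ F (filterᵇ q xs)
    ΣG = Σ G (filterᵇ (not ∘ q) xs)
    by-head : ∀ b → q x ≡ b →
      Σ (H F G) (x ∷ xs) k ≡ (Σ F (filterᵇ q (x ∷ xs)) ⊛ Σ G (filterᵇ (not ∘ q) (x ∷ xs))) k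
    by-head true qx = begin
      Σ (H F G) xs k + Σ (H F G ∘ (x ∷_)) xs k
        ≡⟨ cong (Σ (H F G) xs k +_) (subsetSum-cong-⊆ xs k (λ {S} _ →
             cong₂ (λ S₁ S₂ → (F S₁ ⊛ G S₂) k)
                   (filterᵇ-accept q S qx) (filterᵇ-reject (not ∘ q) S (cong not qx)))) ⟩
      Σ (H F G) xs k + Σ (H (F ∘ (x ∷_)) G) xs k
        ≡⟨ cong₂ _+_ (subsetSum-⊛ q F G xs k) (subsetSum-⊛ q (F ∘ (x ∷_)) G xs k) ⟩
      (ΣF ⊛ ΣG) k + (Σ (F ∘ (x ∷_)) (filterᵇ q xs) ⊛ ΣG) k
        ≡⟨ ⊛-distribʳ-⊕ ΣF _ ΣG k ⟨
      (Σ F (x ∷ filterᵇ q xs) ⊛ ΣG) k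
        ≡⟨ cong₂ (λ S₁ S₂ → (Σ F S₁ ⊛ Σ G S₂) k)
                 (filterᵇ-accept q xs qx) (filterᵇ-reject (not ∘ q) xs (cong not qx)) ⟨
      (Σ F (filterᵇ q (x ∷ xs)) ⊛ Σ G (filterᵇ (not ∘ q) (x ∷ xs))) k ∎
    by-head false qx = begin
      Σ (H F G) xs k + Σ (H F G ∘ (x ∷_)) xs k
        ≡⟨ cong (Σ (H F G) xs k +_) (subsetSum-cong-⊆ xs k (λ {S} _ →
             cong₂ (λ S₁ S₂ → (F S₁ ⊛ G S₂) k)
                   (filterᵇ-reject q S qx) (filterᵇ-accept (not ∘ q) S (cong not qx)))) ⟩
      Σ (H F G) xs k + Σ (H F (G ∘ (x ∷_))) xs k
        ≡⟨ cong₂ _+_ (subsetSum-⊛ q F G xs k) (subsetSum-⊛ q F (G ∘ (x ∷_)) xs k) ⟩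
      (ΣF ⊛ ΣG) k + (ΣF ⊛ Σ (G ∘ (x ∷_)) (filterᵇ (not ∘ q) xs)) k
        ≡⟨ ⊛-distribˡ-⊕ ΣF ΣG _ k ⟨
      (ΣF ⊛ Σ G (x ∷ filterᵇ (not ∘ q) xs)) k
        ≡⟨ cong₂ (λ S₁ S₂ → (Σ F S₁ ⊛ Σ G S₂) k)
                 (filterᵇ-reject q xs qx) (filterᵇ-accept (not ∘ q) xs (cong not qx)) ⟨
      (Σ F (filterᵇ q (x ∷ xs)) ⊛ Σ G (filterᵇ (not ∘ q) (x ∷ xs))) k ∎

coverCount : ℕ → List Tile → ℕ → ℕ
coverCount m S c = countB (λ t → covers m t c) S

exactCover : ℕ → List ℕ → List Tile → Bool
exactCover m Cs S = allB (λ c → coverCount m S c ≡ᵇ 1) Cs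

fenceCount : List Tile → ℕ
fenceCount = countB isFence

weight : ℕ → List ℕ → List Tile → Poly
weight m Cs S = [ exactCover m Cs S ]x^ fenceCount S

tilingPoly : ℕ → List Tile → List ℕ → Poly
tilingPoly m T Cs = subsetSum (weight m Cs) T

boardPoly : ℕ → ℕ → Poly
boardPoly m N = tilingPoly m (candidates m N) (upTo N)

fenceTilings≡boardPoly : ∀ m n k → fenceTilings m n k ≡ boardPoly m (n + k) k
fenceTilings≡boardPoly m n k = countB-subsets (exactCover m (upTo (n + k))) fenceCount (candidates m (n + k)) k

tilingPoly-↭ : ∀ m {T T′} Cs → T ↭ T′ → tilingPoly m T Cs ≈ₚ tilingPoly m T′ Cs
tilingPoly-↭ m Cs = subsetSum-↭ λ S↭S′ k → cong₂ (λ b a → ([ b ]x^ a) k)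
  (allB-cong (λ c → cong (_≡ᵇ 1) (countB-↭ (λ t → covers m t c) S↭S′)) Cs)
  (countB-↭ isFence S↭S′)

tilingPoly-vanish : ∀ m T Cs {k} → fenceCount T < k → tilingPoly m T Cs k ≡ 0
tilingPoly-vanish m T Cs {k} T<k = trans
  (subsetSum-cong-⊆ T k (λ {S} S⊆T → []x^-vanish (exactCover m Cs S) (≤-<-trans (countB-mono-⊆ isFence S⊆T) T<k)))
  (subsetSum-zero T k)

fenceCount-candidates : ∀ m M → fenceCount (candidates m M) ≡ M ∸ m
fenceCount-candidates m M = begin
  fenceCount (map sq (upTo M) ++ map fence (upTo (M ∸ m)))
    ≡⟨ countB-++ isFence (map sq (upTo M)) (map fence (upTo (M ∸ m))) ⟩
  fenceCount (map sq (upTo M)) + fenceCount (map fence (upTo (M ∸ m)))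
    ≡⟨ cong₂ _+_ (no-fences (upTo M)) (all-fences (upTo (M ∸ m))) ⟩
  length (upTo (M ∸ m))
    ≡⟨ length-upTo (M ∸ m) ⟩
  M ∸ m ∎
  where
  open ≡-Reasoning
  no-fences : ∀ xs → fenceCount (map sq xs) ≡ 0
  no-fences []       = refl
  no-fences (_ ∷ xs) = no-fences xs
  all-fences : ∀ xs → fenceCount (map fence xs) ≡ length xs
  all-fences []       = refl
  all-fences (_ ∷ xs) = cong suc (all-fences xs)

boardPoly-vanish : ∀ m M {k} → M ∸ m < k → boardPoly m M k ≡ 0
boardPoly-vanish m M {k} M∸m<k =
  tilingPoly-vanish m (candidates m M) (upTo M) (subst (_< k) (sym (fenceCount-candidates m M)) M∸m<k)

exactCover-∷ : ∀ m t Cs S → allB (λ c → not (covers m t c)) Cs ≡ true → exactCover m Cs (t ∷ S) ≡ exactCover m Cs S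
exactCover-∷ m t []       S _ = refl
exactCover-∷ m t (c ∷ Cs) S h with covers m t c
... | false = cong (_ ∧_) (exactCover-∷ m t Cs S h)

module _ (m : ℕ) (q : Tile → Bool) (p : ℕ → Bool) (compatible : ∀ t c → covers m t c ≡ true → q t ≡ p c) where

  exactCover-partition : ∀ Cs S → exactCover m Cs S
    ≡ exactCover m (filterᵇ p Cs) (filterᵇ q S) ∧ exactCover m (filterᵇ (not ∘ p) Cs) (filterᵇ (not ∘ q) S)
  exactCover-partition Cs S = trans (allB-partition _ p Cs) (cong₂ _∧_
    (allB-cong-filterᵇ p (λ c pc → cong (_≡ᵇ 1) (sym (countB-filterᵇ _ q
      (λ t tc → trans (compatible t c tc) pc) S))) Cs)
    (allB-cong-filterᵇ (not ∘ p) (λ c ¬pc → cong (_≡ᵇ 1) (sym (countB-filterᵇ _ (not ∘ q)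
      (λ t tc → trans (cong not (compatible t c tc)) ¬pc) S))) Cs))

  tilingPoly-⊛ : ∀ T Cs → tilingPoly m T Cs
    ≈ₚ tilingPoly m (filterᵇ q T) (filterᵇ p Cs) ⊛ tilingPoly m (filterᵇ (not ∘ q) T) (filterᵇ (not ∘ p) Cs)
  tilingPoly-⊛ T Cs k = trans
    (subsetSum-cong-⊆ T k (λ {S} _ → weight-⊛ S k))
    (subsetSum-⊛ q (weight m (filterᵇ p Cs)) (weight m (filterᵇ (not ∘ p) Cs)) T k)
    where
    weight-⊛ : ∀ S → weight m Cs S
      ≈ₚ weight m (filterᵇ p Cs) (filterᵇ q S) ⊛ weight m (filterᵇ (not ∘ p) Cs) (filterᵇ (not ∘ q) S)
    weight-⊛ S k = trans
      (cong₂ (λ b a → ([ b ]x^ a) k) (exactCover-partition Cs S) (countB-partition isFence q S))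
      (sym ([]x^-⊛ _ _ (fenceCount (filterᵇ q S)) _ k))

classTiles : (ℕ → ℕ) → ℕ → List Tile
classTiles f ℓ = applyUpTo (sq ∘ f) ℓ ++ applyUpTo (fence ∘ f) (ℓ ∸ 1)

record Progression (m : ℕ) : Set where
  field
    pos       : ℕ → ℕ
    step      : ∀ i → pos i + m ≡ pos (suc i)
    injective : ∀ {i j} → pos i ≡ pos j → i ≡ j

  tail : Progression m
  tail = record { pos = pos ∘ suc ; step = step ∘ suc ; injective = suc-injective ∘ injective }

  covers-sq : ∀ i j → covers m (sq (pos i)) (pos j) ≡ (i ≡ᵇ j)
  covers-sq = ≡ᵇ-injective {pos} injective

  covers-fence : ∀ i j → covers m (fence (pos i)) (pos j) ≡ (i ≡ᵇ j) ∨ (suc i ≡ᵇ j)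
  covers-fence i j = cong₂ _∨_ (covers-sq i j) (trans (cong (_≡ᵇ pos j) (step i)) (covers-sq (suc i) j))

  classTiles-avoid-head : ∀ d ℓ → allB (λ t → not (covers m t (pos 0))) (classTiles (λ i → pos (suc (d + i))) ℓ) ≡ true
  classTiles-avoid-head d ℓ = trans (allB-++ _ (applyUpTo _ ℓ) _) (cong₂ _∧_
    (allB-applyUpTo _ _ (λ i → cong not (covers-sq (suc (d + i)) 0)) ℓ)
    (allB-applyUpTo _ _ (λ i → cong not (covers-fence (suc (d + i)) 0)) (ℓ ∸ 1)))

module FirstCell {m : ℕ} (ψ : Progression m) (ℓ : ℕ) where
  open Progression ψ

  p₀ p₁ : ℕ
  p₀ = pos 0
  p₁ = pos 1

  R R″ : List Tile
  R  = classTiles (pos ∘ suc) (suc ℓ)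
  R″ = classTiles (pos ∘ suc ∘ suc) ℓ

  Cs′ Cs″ : List ℕ
  Cs′ = applyUpTo (pos ∘ suc) (suc ℓ)
  Cs″ = applyUpTo (pos ∘ suc ∘ suc) ℓ

  W : List Tile → Poly
  W = weight m (applyUpTo pos (suc (suc ℓ)))

  avoids : ℕ → Tile → Bool
  avoids c t = not (covers m t c)

  R-avoids-p₀ : allB (avoids p₀) R ≡ true
  R-avoids-p₀ = classTiles-avoid-head 0 (suc ℓ)

  uncovered : subsetSum W R ≈ₚ 0ₚ
  uncovered k = trans
    (subsetSum-cong-⊆ R k (λ {S} S⊆R → vanish S (allB-⊆ _ S⊆R R-avoids-p₀)))
    (subsetSum-zero R k)
    where
    vanish : ∀ S → allB (avoids p₀) S ≡ true → W S k ≡ 0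
    vanish S h rewrite countB-none (λ t → covers m t p₀) S h = refl

  doubly-covered : subsetSum (λ S → W (sq p₀ ∷ fence p₀ ∷ S)) R ≈ₚ 0ₚ
  doubly-covered k = trans (subsetSum-cong-⊆ R k (λ {S} _ → vanish S)) (subsetSum-zero R k)
    where
    vanish : ∀ S → W (sq p₀ ∷ fence p₀ ∷ S) k ≡ 0
    vanish S rewrite covers-sq 0 0 = refl

  square-first : subsetSum (λ S → W (sq p₀ ∷ S)) R ≈ₚ tilingPoly m R Cs′
  square-first k = subsetSum-cong-⊆ R k (λ {S} S⊆R → drop-square S (allB-⊆ _ S⊆R R-avoids-p₀))
    where
    drop-square : ∀ S → allB (avoids p₀) S ≡ true → W (sq p₀ ∷ S) k ≡ weight m Cs′ S k
    drop-square S h rewrite covers-sq 0 0 | countB-none (λ t → covers m t p₀) S h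
      | exactCover-∷ m (sq p₀) Cs′ S (allB-applyUpTo _ _ (λ i → cong not (covers-sq 0 (suc i))) (suc ℓ)) = refl

  fence-first : subsetSum (λ S → W (fence p₀ ∷ S)) R ≈ₚ xTimes (tilingPoly m R″ Cs″)
  fence-first k = begin
    subsetSum Wf R k                        ≡⟨ subsetSum-filterᵇ (avoids p₁) p₁-twice R k ⟩
    subsetSum Wf (filterᵇ (avoids p₁) R) k  ≡⟨ cong (λ T → subsetSum Wf T k) R-without-p₁ ⟩
    subsetSum Wf R″ k                       ≡⟨ subsetSum-cong-⊆ R″ k (λ {S} S⊆R″ → drop-fence S
                                                 (allB-⊆ _ S⊆R″ (classTiles-avoid-head 1 ℓ))
                                                 (allB-⊆ _ S⊆R″ (Progression.classTiles-avoid-head tail 0 ℓ))) ⟩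
    subsetSum (xTimes ∘ weight m Cs″) R″ k  ≡⟨ subsetSum-xTimes (weight m Cs″) R″ k ⟩
    xTimes (tilingPoly m R″ Cs″) k          ∎
    where
    open ≡-Reasoning
    Wf : List Tile → Poly
    Wf S = W (fence p₀ ∷ S)
    p₁-twice : ∀ S → allB (avoids p₁) S ≡ false → Wf S ≈ₚ 0ₚ
    p₁-twice S bad k rewrite covers-fence 0 0 | covers-fence 0 1 | countB≡ᵇ0 (λ t → covers m t p₁) S | bad
      | ∧-zeroʳ (countB (λ t → covers m t p₀) S ≡ᵇ 0) = refl
    R-without-p₁ : filterᵇ (avoids p₁) R ≡ R″
    R-without-p₁ = trans (filter-++ (T? ∘ avoids p₁) (applyUpTo (sq ∘ pos ∘ suc) (suc ℓ)) _) (cong₂ _++_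
      (filterᵇ-applyUpTo-drop-head (avoids p₁) (sq ∘ pos ∘ suc)
        (cong not (covers-sq 1 1)) (λ i → cong not (covers-sq (suc (suc i)) 1)) (suc ℓ))
      (filterᵇ-applyUpTo-drop-head (avoids p₁) (fence ∘ pos ∘ suc)
        (cong not (covers-fence 1 1)) (λ i → cong not (covers-fence (suc (suc i)) 1)) ℓ))
    drop-fence : ∀ S → allB (avoids p₀) S ≡ true → allB (avoids p₁) S ≡ true → Wf S k ≡ xTimes (weight m Cs″ S) k
    drop-fence S h₀ h₁ rewrite covers-fence 0 0 | covers-fence 0 1
      | countB-none (λ t → covers m t p₀) S h₀ | countB-none (λ t → covers m t p₁) S h₁
      | exactCover-∷ m (fence p₀) Cs″ S (allB-applyUpTo _ _ (λ i → cong not (covers-fence 0 (suc (suc i)))) ℓ)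
      = x^-suc (exactCover m Cs″ S) (fenceCount S) k

  tilingPoly-first-cell : ∀ {P₁ P₀} → tilingPoly m R Cs′ ≈ₚ P₁ → tilingPoly m R″ Cs″ ≈ₚ P₀ →
    tilingPoly m (classTiles pos (suc (suc ℓ))) (applyUpTo pos (suc (suc ℓ))) ≈ₚ P₁ ⊕ xTimes P₀
  tilingPoly-first-cell {P₁} {P₀} R≈ R″≈ k = begin
    tilingPoly m (classTiles pos (suc (suc ℓ))) (applyUpTo pos (suc (suc ℓ))) k
      ≡⟨ tilingPoly-↭ m (applyUpTo pos (suc (suc ℓ)))
           (↭.prep (sq p₀) (shift (fence p₀) (applyUpTo (sq ∘ pos ∘ suc) (suc ℓ)) _)) k ⟩
    (Σ W + Σ (λ S → W (fence p₀ ∷ S))) + (Σ (λ S → W (sq p₀ ∷ S)) + Σ (λ S → W (sq p₀ ∷ fence p₀ ∷ S)))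
      ≡⟨ cong₂ _+_ (cong₂ _+_ (uncovered k) (trans (fence-first k) (xTimes-cong R″≈ k)))
                   (cong₂ _+_ (trans (square-first k) (R≈ k)) (doubly-covered k)) ⟩
    (0 + xTimes P₀ k) + (P₁ k + 0)
      ≡⟨ trans (cong (xTimes P₀ k +_) (+-identityʳ (P₁ k))) (+-comm (xTimes P₀ k) (P₁ k)) ⟩
    P₁ k + xTimes P₀ k ∎
    where
    open ≡-Reasoning
    Σ : (List Tile → Poly) → ℕ
    Σ V = subsetSum V R k

tilingPoly-progression : ∀ {m} (ψ : Progression m) ℓ →
  tilingPoly m (classTiles (Progression.pos ψ) ℓ) (applyUpTo (Progression.pos ψ) ℓ) ≈ₚ fib ℓ
tilingPoly-progression ψ zero    zero    = refl
tilingPoly-progression ψ zero    (suc k) = refl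
tilingPoly-progression ψ (suc zero) k rewrite Progression.covers-sq ψ 0 0 with k
... | zero  = refl
... | suc _ = refl
tilingPoly-progression ψ (suc (suc ℓ)) = FirstCell.tilingPoly-first-cell ψ ℓ
  (tilingPoly-progression (Progression.tail ψ) (suc ℓ))
  (tilingPoly-progression (Progression.tail (Progression.tail ψ)) ℓ)

between : ℕ → ℕ → ℕ → Bool
between a b x = not (x <ᵇ a) ∧ (x <ᵇ b)

between-empty : ∀ a x → between a a x ≡ false
between-empty a x with x <ᵇ a
... | true  = refl
... | false = refl

between-top : ∀ {a s} → a ≤ s → ∀ x → between a (suc s) x ∧ (x ≡ᵇ s) ≡ (x ≡ᵇ s)
between-top {a} {s} a≤s x with x ≡ᵇ s in x≡s
... | false = ∧-zeroʳ _
... | true rewrite ≡ᵇ≡true⇒≡ {x} {s} x≡s | ≤⇒<ᵇ≡false a≤s | <⇒<ᵇ≡true (≤-refl {suc s}) = refl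

between-below : ∀ a s x → between a (suc s) x ∧ not (x ≡ᵇ s) ≡ between a s x
between-below a s x rewrite <ᵇ-suc x s with x ≡ᵇ s in x≡s
... | true rewrite ≡ᵇ≡true⇒≡ {x} {s} x≡s | ≤⇒<ᵇ≡false (≤-refl {s}) = trans (∧-zeroʳ _) (sym (∧-zeroʳ _))
... | false = trans (∧-identityʳ _) (cong (not (x <ᵇ a) ∧_) (∨-identityʳ (x <ᵇ s)))

module ResidueClasses (m : ℕ) ⦃ _ : NonZero m ⦄ where

  residue : Tile → ℕ
  residue (sq p)    = p % m
  residue (fence p) = p % m

  residue<m : ∀ t → residue t < m
  residue<m (sq p)    = m%n<n p m
  residue<m (fence p) = m%n<n p m

  residue-covers : ∀ t c → covers m t c ≡ true → residue t ≡ c % m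
  residue-covers (sq p)    c h = cong (_% m) (≡ᵇ≡true⇒≡ h)
  residue-covers (fence p) c h with p ≡ᵇ c in p≡c
  ... | true  = cong (_% m) (≡ᵇ≡true⇒≡ p≡c)
  ... | false = trans (sym ([m+n]%n≡m%n p m)) (cong (_% m) (≡ᵇ≡true⇒≡ h))

  classCell : ℕ → ℕ → ℕ
  classCell c i = c + i * m

  classProgression : ℕ → Progression m
  classProgression c = record
    { pos       = classCell c
    ; step      = λ i → trans (+-assoc c (i * m) m) (cong (c +_) (+-comm (i * m) m))
    ; injective = λ {i} {j} eq → *-cancelʳ-≡ i j m (+-cancelˡ-≡ c (i * m) (j * m) eq)
    }

  classLength : ℕ → ℕ → ℕ → ℕ
  classLength c j r = if c <ᵇ r then suc j else j

  inClass : ℕ → ℕ → Bool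
  inClass c x = x % m ≡ᵇ c

  classCells : ∀ {c} → c < m → ∀ j r → r ≤ m →
    filterᵇ (inClass c) (upTo (j * m + r)) ≡ applyUpTo (classCell c) (classLength c j r)
  classCells c<m zero    zero    _ = refl
  classCells {c} c<m (suc j) zero _ = begin
    filterᵇ (inClass c) (upTo (m + j * m + 0))
      ≡⟨ cong (filterᵇ (inClass c) ∘ upTo) (trans (+-identityʳ _) (+-comm m (j * m))) ⟩
    filterᵇ (inClass c) (upTo (j * m + m))
      ≡⟨ classCells c<m j m ≤-refl ⟩
    applyUpTo (classCell c) (classLength c j m)
      ≡⟨ cong (λ b → applyUpTo (classCell c) (if b then suc j else j)) (<⇒<ᵇ≡true c<m) ⟩
    applyUpTo (classCell c) (suc j) ∎
    where open ≡-Reasoning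
  classCells {c} c<m j (suc r) r<m = begin
    filterᵇ (inClass c) (upTo (j * m + suc r))
      ≡⟨ cong (filterᵇ (inClass c)) (trans (cong upTo (+-suc (j * m) r)) (sym (upTo-∷ʳ (j * m + r)))) ⟩
    filterᵇ (inClass c) (upTo (j * m + r) ++ [ j * m + r ])
      ≡⟨ filter-++ (T? ∘ inClass c) (upTo (j * m + r)) [ j * m + r ] ⟩
    filterᵇ (inClass c) (upTo (j * m + r)) ++ filterᵇ (inClass c) [ j * m + r ]
      ≡⟨ cong (_++ filterᵇ (inClass c) [ j * m + r ]) (classCells c<m j r (<⇒≤ r<m)) ⟩
    applyUpTo (classCell c) (classLength c j r) ++ filterᵇ (inClass c) [ j * m + r ]
      ≡⟨ last-cell (r ≟ c) ⟩
    applyUpTo (classCell c) (classLength c j (suc r)) ∎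
    where
    open ≡-Reasoning
    residue-last : (j * m + r) % m ≡ r
    residue-last = trans (cong (_% m) (+-comm (j * m) r)) (trans ([m+kn]%n≡m%n r j m) (m<n⇒m%n≡m r<m))
    last-cell : Dec (r ≡ c) → applyUpTo (classCell c) (classLength c j r) ++ filterᵇ (inClass c) [ j * m + r ]
                             ≡ applyUpTo (classCell c) (classLength c j (suc r))
    last-cell (yes refl)
      rewrite residue-last | ≡ᵇ-refl r | ≤⇒<ᵇ≡false (≤-refl {r}) | <⇒<ᵇ≡true (≤-refl {suc r}) =
      trans (cong (λ x → applyUpTo (classCell r) j ++ [ x ]) (+-comm (j * m) r)) (applyUpTo-∷ʳ (classCell r) j)
    last-cell (no r≢c)
      rewrite residue-last | ≢⇒≡ᵇ≡false r≢c | <ᵇ-suc c r | ≢⇒≡ᵇ≡false (r≢c ∘ sym) | ∨-identityʳ (c <ᵇ r) =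
      ++-identityʳ _

  classFences : ∀ {c} → c < m → ∀ j r → r < m →
    filterᵇ (inClass c) (upTo (j * m + r ∸ m)) ≡ applyUpTo (classCell c) (classLength c j r ∸ 1)
  classFences {c} c<m zero    r r<m rewrite m≤n⇒m∸n≡0 (<⇒≤ r<m) with c <ᵇ r
  ... | true  = refl
  ... | false = refl
  classFences {c} c<m (suc j) r r<m = begin
    filterᵇ (inClass c) (upTo (m + j * m + r ∸ m))
      ≡⟨ cong (filterᵇ (inClass c) ∘ upTo) (trans (cong (_∸ m) (+-assoc m (j * m) r)) (m+n∸m≡n m (j * m + r))) ⟩
    filterᵇ (inClass c) (upTo (j * m + r))
      ≡⟨ classCells c<m j r (<⇒≤ r<m) ⟩
    applyUpTo (classCell c) (classLength c j r)
      ≡⟨ cong (applyUpTo (classCell c)) (pred-classLength (c <ᵇ r)) ⟩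
    applyUpTo (classCell c) (classLength c (suc j) r ∸ 1) ∎
    where
    open ≡-Reasoning
    pred-classLength : ∀ b → (if b then suc j else j) ≡ (if b then suc (suc j) else suc j) ∸ 1
    pred-classLength true  = refl
    pred-classLength false = refl

  classTiles-candidates : ∀ {c} N ℓ → filterᵇ (inClass c) (upTo N) ≡ applyUpTo (classCell c) ℓ →
    filterᵇ (inClass c) (upTo (N ∸ m)) ≡ applyUpTo (classCell c) (ℓ ∸ 1) →
    filterᵇ (λ t → residue t ≡ᵇ c) (candidates m N) ≡ classTiles (classCell c) ℓ
  classTiles-candidates {c} N ℓ cells fences = begin
    filterᵇ P (map sq (upTo N) ++ map fence (upTo (N ∸ m)))
      ≡⟨ filter-++ (T? ∘ P) (map sq (upTo N)) _ ⟩
    filterᵇ P (map sq (upTo N)) ++ filterᵇ P (map fence (upTo (N ∸ m)))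
      ≡⟨ cong₂ _++_ (filterᵇ-map P sq (upTo N)) (filterᵇ-map P fence (upTo (N ∸ m))) ⟩
    map sq (filterᵇ (inClass c) (upTo N)) ++ map fence (filterᵇ (inClass c) (upTo (N ∸ m)))
      ≡⟨ cong₂ (λ xs ys → map sq xs ++ map fence ys) cells fences ⟩
    map sq (applyUpTo (classCell c) ℓ) ++ map fence (applyUpTo (classCell c) (ℓ ∸ 1))
      ≡⟨ cong₂ _++_ (map-applyUpTo (classCell c) sq ℓ) (map-applyUpTo (classCell c) fence (ℓ ∸ 1)) ⟩
    classTiles (classCell c) ℓ ∎
    where
    open ≡-Reasoning
    P : Tile → Bool
    P t = residue t ≡ᵇ c

  module Board (j r : ℕ) (r<m : r < m) where

    N : ℕ
    N = j * m + r

    classesPoly : (ℕ → Bool) → Poly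
    classesPoly R = tilingPoly m (filterᵇ (R ∘ residue) (candidates m N)) (filterᵇ (R ∘ (_% m)) (upTo N))

    classesPoly-⊛ : ∀ R Q → classesPoly R ≈ₚ classesPoly (λ x → R x ∧ Q x) ⊛ classesPoly (λ x → R x ∧ not (Q x))
    classesPoly-⊛ R Q k = trans
      (tilingPoly-⊛ m (Q ∘ residue) (Q ∘ (_% m)) (λ t c h → cong Q (residue-covers t c h))
                    (filterᵇ (R ∘ residue) (candidates m N)) (filterᵇ (R ∘ (_% m)) (upTo N)) k)
      (cong₂ (λ p q → (p ⊛ q) k) (restrict Q) (restrict (not ∘ Q)))
      where
      restrict : ∀ Q′ → tilingPoly m (filterᵇ (Q′ ∘ residue) (filterᵇ (R ∘ residue) (candidates m N)))
                                      (filterᵇ (Q′ ∘ (_% m)) (filterᵇ (R ∘ (_% m)) (upTo N)))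
                      ≡ classesPoly (λ x → R x ∧ Q′ x)
      restrict Q′ = cong₂ (tilingPoly m) (filterᵇ-filterᵇ _ _ (candidates m N)) (filterᵇ-filterᵇ _ _ (upTo N))

    classesPoly-cong : ∀ {R R′} → (∀ x → x < m → R x ≡ R′ x) → classesPoly R ≡ classesPoly R′
    classesPoly-cong R≡ = cong₂ (tilingPoly m)
      (filterᵇ-cong (λ t → R≡ (residue t) (residue<m t)) (candidates m N))
      (filterᵇ-cong (λ x → R≡ (x % m) (m%n<n x m)) (upTo N))

    classesPoly-none : classesPoly (λ _ → false) ≈ₚ one
    classesPoly-none k rewrite filterᵇ-false (candidates m N) | filterᵇ-false (upTo N) with k
    ... | zero  = refl
    ... | suc _ = refl

    classesPoly-single : ∀ c → c < m → classesPoly (_≡ᵇ c) ≈ₚ fib (classLength c j r)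
    classesPoly-single c c<m k = trans
      (cong (λ p → p k) (cong₂ (tilingPoly m) (classTiles-candidates N (classLength c j r) cells fences) cells))
      (tilingPoly-progression (classProgression c) (classLength c j r) k)
      where
      cells : filterᵇ (inClass c) (upTo N) ≡ applyUpTo (classCell c) (classLength c j r)
      cells = classCells c<m j r (<⇒≤ r<m)
      fences : filterᵇ (inClass c) (upTo (N ∸ m)) ≡ applyUpTo (classCell c) (classLength c j r ∸ 1)
      fences = classFences c<m j r r<m

    classesPoly-interval : ∀ {P} a d → (∀ c → a ≤ c → c < d + a → classesPoly (_≡ᵇ c) ≈ₚ P) →
      classesPoly (between a (d + a)) ≈ₚ P ^ₚ d
    classesPoly-interval a zero    _     k =
      trans (cong (λ p → p k) (classesPoly-cong (λ x _ → between-empty a x))) (classesPoly-none k)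
    classesPoly-interval {P} a (suc d) class≈ k = begin
      classesPoly (between a (suc (d + a))) k
        ≡⟨ classesPoly-⊛ (between a (suc (d + a))) (_≡ᵇ (d + a)) k ⟩
      (classesPoly (λ x → between a (suc (d + a)) x ∧ (x ≡ᵇ d + a))
        ⊛ classesPoly (λ x → between a (suc (d + a)) x ∧ not (x ≡ᵇ d + a))) k
        ≡⟨ cong₂ (λ p q → (p ⊛ q) k) (classesPoly-cong (λ x _ → between-top (m≤n+m a d) x))
                                     (classesPoly-cong (λ x _ → between-below a (d + a) x)) ⟩
      (classesPoly (_≡ᵇ (d + a)) ⊛ classesPoly (between a (d + a))) k
        ≡⟨ ⊛-cong (class≈ (d + a) (m≤n+m a d) ≤-refl)
                  (classesPoly-interval a d (λ c a≤c c< → class≈ c a≤c (m<n⇒m<1+n c<))) k ⟩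
      (P ⊛ (P ^ₚ d)) k ∎
      where open ≡-Reasoning

    boardPoly≈ : boardPoly m N ≈ₚ (fib j ^ₚ (m ∸ r)) ⊛ (fib (suc j) ^ₚ r)
    boardPoly≈ k = begin
      boardPoly m N k
        ≡⟨ cong (λ p → p k) (cong₂ (tilingPoly m) (filterᵇ-true (candidates m N)) (filterᵇ-true (upTo N))) ⟨
      classesPoly (λ _ → true) k
        ≡⟨ classesPoly-⊛ (λ _ → true) (λ x → not (x <ᵇ r)) k ⟩
      (classesPoly (λ x → not (x <ᵇ r)) ⊛ classesPoly (λ x → not (not (x <ᵇ r)))) k
        ≡⟨ cong₂ (λ p q → (p ⊛ q) k) (classesPoly-cong upper) (classesPoly-cong lower) ⟩
      (classesPoly (between r (m ∸ r + r)) ⊛ classesPoly (between 0 (r + 0))) k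
        ≡⟨ ⊛-cong (classesPoly-interval r (m ∸ r)
                    (λ c r≤c c< → class-above c r≤c (subst (c <_) (m∸n+n≡m r≤m) c<)))
                  (classesPoly-interval 0 r (λ c _ c< → class-below c (subst (c <_) (+-identityʳ r) c<))) k ⟩
      ((fib j ^ₚ (m ∸ r)) ⊛ (fib (suc j) ^ₚ r)) k ∎
      where
      open ≡-Reasoning
      r≤m : r ≤ m
      r≤m = <⇒≤ r<m
      upper : ∀ x → x < m → not (x <ᵇ r) ≡ between r (m ∸ r + r) x
      upper x x<m rewrite m∸n+n≡m r≤m | <⇒<ᵇ≡true x<m = sym (∧-identityʳ _)
      lower : ∀ x → x < m → not (not (x <ᵇ r)) ≡ between 0 (r + 0) x
      lower x _ rewrite +-identityʳ r = not-involutive (x <ᵇ r)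
      class-above : ∀ c → r ≤ c → c < m → classesPoly (_≡ᵇ c) ≈ₚ fib j
      class-above c r≤c c<m k = trans (classesPoly-single c c<m k)
        (cong (λ b → fib (if b then suc j else j) k) (≤⇒<ᵇ≡false r≤c))
      class-below : ∀ c → c < r → classesPoly (_≡ᵇ c) ≈ₚ fib (suc j)
      class-below c c<r k = trans (classesPoly-single c (<-trans c<r r<m) k)
        (cong (λ b → fib (if b then suc j else j) k) (<⇒<ᵇ≡true c<r))

-- For k > N the truncation N ∸ k = 0 leaves the k-board, and both sides vanish because
-- neither board has room for k fences.
fenceTilings≡boardPoly-∸ : ∀ m N k → 1 ≤ m → fenceTilings m (N ∸ k) k ≡ boardPoly m N k
fenceTilings≡boardPoly-∸ m N k 1≤m with k ≤? N
... | yes k≤N = trans (fenceTilings≡boardPoly m (N ∸ k) k) (cong (λ M → boardPoly m M k) (m∸n+n≡m k≤N))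
... | no  k≰N = begin
  fenceTilings m (N ∸ k) k  ≡⟨ fenceTilings≡boardPoly m (N ∸ k) k ⟩
  boardPoly m (N ∸ k + k) k ≡⟨ cong (λ M → boardPoly m (M + k) k) (m≤n⇒m∸n≡0 (<⇒≤ N<k)) ⟩
  boardPoly m k k           ≡⟨ boardPoly-vanish m k (∸-< 1≤m (≤-<-trans z≤n N<k)) ⟩
  0                         ≡⟨ boardPoly-vanish m N (≤-<-trans (m∸n≤m N m) N<k) ⟨
  boardPoly m N k           ∎
  where
  open ≡-Reasoning
  N<k : N < k
  N<k = ≰⇒> k≰N
  ∸-< : ∀ {a b} → 0 < a → 0 < b → b ∸ a < b
  ∸-< {suc a} {suc b} _ _ = s≤s (m∸n≤m b a)

theorem14 : (j k m r : ℕ) → 1 ≤ m → r < m →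
    fenceTilings m (m * j + r ∸ k) k
      ≡ coeff k ((fib j ^ₚ (m ∸ r)) ⊛ (fib (suc j) ^ₚ r))
theorem14 j k m@(suc _) r 1≤m r<m = begin
  fenceTilings m (m * j + r ∸ k) k                  ≡⟨ fenceTilings≡boardPoly-∸ m (m * j + r) k 1≤m ⟩
  boardPoly m (m * j + r) k                         ≡⟨ cong (λ N → boardPoly m (N + r) k) (*-comm m j) ⟩
  boardPoly m (j * m + r) k                         ≡⟨ Board.boardPoly≈ j r r<m k ⟩
  coeff k ((fib j ^ₚ (m ∸ r)) ⊛ (fib (suc j) ^ₚ r)) ∎
  where
  open ≡-Reasoning
  open ResidueClasses m
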